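{- Let $q$ be a prime power, $t,n,k$ positive integers, and $1\le \lambda'\le\lambda$. If $C$ is a $\mathrm{CPHF}_{\lambda}(n;t,k,q)$, then there exists a $\mathrm{CA}_{\lambda'}(n(q^t-1)+\lambda';\,t,k,q)$. If moreover $C$ is an $\mathrm{SCPHF}_{\lambda}(n;t,k,q)$, then there exists a $\mathrm{CA}_{\lambda'}(n(q^t-q)+\lambda' q;\,t,k,q)$.
   Context: A covering perfect hash family $\mathrm{CPHF}_{\lambda}(n;t,k,q)$ is an $n\times k$ array with entries from $\mathbb{F}_q^t\setminus\{\vec 0\}$ such that for each set $T$ of $t$ columns there exist at least $\lambda$ rows whose entries in the columns of $T$ are linearly independent over $\mathbb{F}_q$. If all vector entries have nonzero last coordinate, it is a Sherwood covering perfect hash family $\mathrm{SCPHF}_{\lambda}(n;t,k,q)$. A covering array $\mathrm{CA}_{\lambda}(N;t,k,v)$ is an $N\times k$ array with entries from a $v$-set such that for every set $T$ of $t$ columns and every $t$-tuple over the $v$-set, at least $\lambda$ rows have entries in the columns of $T$ equal to that $t$-tuple. -}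

module Defs where

open import Data.Nat using (ℕ; zero; suc; _≤_; _^_; _∸_)
open import Data.Nat.Primality using (Prime)
open import Data.Fin using (Fin; toℕ)
open import Data.Product using (Σ; ∃; _×_; _,_)
open import Relation.Binary.PropositionalEquality using (_≡_; _≢_)
open import Relation.Nullary using (¬_)
open import Algebra.Core using (Op₁; Op₂)
open import Algebra.Structures using (IsCommutativeRing)
open import Function.Definitions using (Injective)

IsPrimePower : ℕ → Set
IsPrimePower q = Σ ℕ λ p → Σ ℕ λ e → Prime p × (1 ≤ e) × (q ≡ p ^ e)

-- A finite field with q elements, realised on the carrier Fin q
-- (every finite field of order q is isomorphic to one of these).
record FiniteField (q : ℕ) : Set where
  field
    _+_ _*_ : Op₂ (Fin q)
    -_      : Op₁ (Fin q)
    0# 1#   : Fin q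
    isCommutativeRing : IsCommutativeRing _≡_ _+_ _*_ -_ 0# 1#
    0≢1     : 0# ≢ 1#
    inverse : ∀ x → x ≢ 0# → ∃ λ y → x * y ≡ 1#

module _ {q : ℕ} (F : FiniteField q) where
  open FiniteField F

  Vect : ℕ → Set
  Vect t = Fin t → Fin q

  sumF : ∀ {m} → (Fin m → Fin q) → Fin q
  sumF {zero}  f = 0#
  sumF {suc m} f = f Fin.zero + sumF (λ i → f (Fin.suc i))

  NonZeroVec : ∀ {t} → Vect t → Set
  NonZeroVec v = ¬ (∀ j → v j ≡ 0#)

  LinIndep : ∀ {t m} → (Fin m → Vect t) → Set
  LinIndep {t} {m} v =
    (c : Fin m → Fin q) → (∀ (j : Fin t) → sumF (λ i → c i * v i j) ≡ 0#) → ∀ i → c i ≡ 0#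

  record CPHF (lam n t k : ℕ) : Set where
    field
      entry   : Fin n → Fin k → Vect t
      nonzero : ∀ r c → NonZeroVec (entry r c)
      covers  : (cols : Fin t → Fin k) → Injective _≡_ _≡_ cols →
                Σ (Fin lam → Fin n) λ rows → Injective _≡_ _≡_ rows ×
                  (∀ j → LinIndep (λ i → entry (rows j) (cols i)))

  IsSherwood : ∀ {lam n t k} → CPHF lam n t k → Set
  IsSherwood {t = t} C =
    ∀ r c (i : Fin t) → toℕ i ≡ t ∸ 1 → CPHF.entry C r c i ≢ 0#

record CA (lam N t k v : ℕ) : Set where
  field
    array  : Fin N → Fin k → Fin v
    covers : (cols : Fin t → Fin k) → Injective _≡_ _≡_ cols → (u : Fin t → Fin v) →
             Σ (Fin lam → Fin N) λ rows → Injective _≡_ _≡_ rows ×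
               (∀ j i → array (rows j) (cols i) ≡ u i)

-- Each row r of a CPHF and each nonzero u ∈ F_q^t give the covering array row
-- c ↦ u · C(r,c); λ' all-zero rows are added. Given t columns and a nonzero target w,
-- each of λ' rows r in which the t entries are linearly independent makes the system
-- u · C(r,c_i) = w_i solvable, and u ≠ 0 because w ≠ 0, so w is covered λ' times.
-- In the Sherwood case (every entry has invertible last coordinate b) the rows are
-- c ↦ b⁻¹ (u · C(r,c)) with u ranging over vectors whose first t − 1 coordinates are not
-- all zero; such a row is constant exactly when those coordinates vanish, so the λ' q
-- constant rows replace the n(q − 1) rows that would otherwise be spent on them.
{-# OPTIONS --safe #-}
module Submission where

open import Defs
open import Level using (0ℓ)
open import Algebra.Bundles using (CommutativeRing)
import Algebra.Properties.Ring as RingProperties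
import Algebra.Properties.AbelianGroup as AbelianGroupProperties
import Algebra.Properties.CommutativeSemigroup as CommutativeSemigroupProperties
open import Data.Nat as ℕ using (ℕ; zero; suc; NonZero; s≤s; z≤n)
open import Data.Nat.Properties as ℕ
  using (1+n≰n; suc-pred; m^n≢0; pred[m∸n]≡m∸[1+n]; *-distribʳ-∸)
open import Data.Fin using (Fin; fromℕ; cast; punchIn; punchOut; inject≤; finToFun; funToFin; combine)
open import Data.Fin.Properties
  using (_≟_; any?; all?; injective⇒≤; punchOut-injective; punchIn-punchOut; inject≤-injective;
         cast-involutive; finToFun-funToFin; funToFin-finToFin; toℕ-fromℕ; nonZeroIndex; +↔⊎; *↔×)
open import Data.Vec.Functional using (init; last)
open import Data.Product using (Σ; ∃; _×_; _,_; proj₁; proj₂)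
open import Data.Product.Function.NonDependent.Propositional using (_×-↔_)
open import Data.Sum using (_⊎_; inj₁; inj₂)
open import Data.Sum.Properties using (inj₁-injective; inj₂-injective)
open import Data.Sum.Function.Propositional using (_⊎-↔_)
open import Function using (_↔_; Inverse; const; _∘′_)
open import Function.Definitions using (Injective)
open import Function.Properties.Inverse using (↔-refl; ↔-trans)
open import Relation.Binary.PropositionalEquality
open import Relation.Nullary using (yes; no; contradiction)

Fin-injective⇒surjective : ∀ {n} {f : Fin n → Fin n} → Injective _≡_ _≡_ f → ∀ y → ∃ λ x → f x ≡ y
Fin-injective⇒surjective {zero} _ ()
Fin-injective⇒surjective {suc n} {f} f-injective y with any? (λ x → f x ≟ y)
... | yes hit = hit
... | no miss = contradiction (injective⇒≤ punchOut∘f-injective) 1+n≰n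
  where
  y≢f : ∀ x → y ≢ f x
  y≢f x y≡fx = miss (x , sym y≡fx)
  punchOut∘f-injective : Injective _≡_ _≡_ (λ x → punchOut (y≢f x))
  punchOut∘f-injective eq = f-injective (punchOut-injective (y≢f _) (y≢f _) eq)

funToFin-cong : ∀ {m n} {u v : Fin m → Fin n} → u ≗ v → funToFin u ≡ funToFin v
funToFin-cong {zero} _ = refl
funToFin-cong {suc m} u≗v = cong₂ combine (u≗v Fin.zero) (funToFin-cong (λ i → u≗v (Fin.suc i)))

-- Counting argument: such an f induces an injective, hence surjective, map on Fin (n ^ m).
≗-injective⇒surjective : ∀ {m n} (f : (Fin m → Fin n) → Fin m → Fin n) →
  (∀ {u v} → u ≗ v → f u ≗ f v) → (∀ {u v} → f u ≗ f v → u ≗ v) →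
  ∀ w → ∃ λ u → f u ≗ w
≗-injective⇒surjective {m} {n} f f-cong f-injective w =
  let x , gx≡w = Fin-injective⇒surjective g-injective (funToFin w) in
  decode x , λ i → trans (sym (decode-g x i)) (trans (cong (λ y → decode y i) gx≡w) (finToFun-funToFin w i))
  where
  decode : Fin (n ℕ.^ m) → Fin m → Fin n
  decode = finToFun
  g : Fin (n ℕ.^ m) → Fin (n ℕ.^ m)
  g x = funToFin (f (decode x))
  decode-g : ∀ x → decode (g x) ≗ f (decode x)
  decode-g x = finToFun-funToFin (f (decode x))
  g-injective : Injective _≡_ _≡_ g
  g-injective {x} {y} gx≡gy = begin
    x                     ≡⟨ funToFin-finToFin {m} {n} x ⟨
    funToFin (decode x)   ≡⟨ funToFin-cong (f-injective λ i →
                               trans (sym (decode-g x i)) (trans (cong (λ z → decode z i) gx≡gy) (decode-g y i))) ⟩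
    funToFin (decode y)   ≡⟨ funToFin-finToFin {m} {n} y ⟩
    y                     ∎
    where open ≡-Reasoning

m^n≡1+[m^n∸1] : ∀ m .{{_ : NonZero m}} n → m ℕ.^ n ≡ suc (m ℕ.^ n ℕ.∸ 1)
m^n≡1+[m^n∸1] m n = trans (sym (suc-pred (m ℕ.^ n) {{m^n≢0 m n}})) (cong suc (pred[m∸n]≡m∸[1+n] (m ℕ.^ n) 0))

[m^n∸1]*m≡m^[1+n]∸m : ∀ m n → (m ℕ.^ n ℕ.∸ 1) ℕ.* m ≡ m ℕ.^ suc n ℕ.∸ m
[m^n∸1]*m≡m^[1+n]∸m m n =
  trans (*-distribʳ-∸ m (m ℕ.^ n) 1) (cong₂ ℕ._∸_ (ℕ.*-comm (m ℕ.^ n) m) (ℕ.*-identityˡ m))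

inj₁-pair-injective : ∀ {I A B C : Set} {f : I → A} (g : I → B) → Injective _≡_ _≡_ f →
  Injective _≡_ _≡_ (λ i → inj₁ {B = C} (f i , g i))
inj₁-pair-injective g f-injective eq = f-injective (cong proj₁ (inj₁-injective eq))

Covers : (lam t : ℕ) {R : Set} {k v : ℕ} → (R → Fin k → Fin v) → Set
Covers lam t {R} {k} {v} row =
  (cols : Fin t → Fin k) → Injective _≡_ _≡_ cols → (u : Fin t → Fin v) →
  Σ (Fin lam → R) λ rows → Injective _≡_ _≡_ rows × (∀ j i → row (rows j) (cols i) ≡ u i)

Covers⇒CA : ∀ {lam N t k v} {R : Set} → Fin N ↔ R → (row : R → Fin k → Fin v) →
  Covers lam t row → CA lam N t k v
Covers⇒CA {R = R} index row covers = record
  { array  = λ x → row (to x)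
  ; covers = λ cols cols-injective u →
      let rows , rows-injective , hit = covers cols cols-injective u in
      (λ j → from (rows j)) ,
      (λ eq → rows-injective (from-injective eq)) ,
      (λ j i → trans (cong (λ r → row r (cols i)) (strictlyInverseˡ (rows j))) (hit j i))
  }
  where
  open Inverse index
  from-injective : ∀ {r s : R} → from r ≡ from s → r ≡ s
  from-injective {r} {s} eq = trans (sym (strictlyInverseˡ r)) (trans (cong to eq) (strictlyInverseˡ s))

module _ {q : ℕ} (F : FiniteField q) where

  private
    commutativeRing : CommutativeRing 0ℓ 0ℓ
    commutativeRing = record { isCommutativeRing = FiniteField.isCommutativeRing F }

  open CommutativeRing commutativeRing
    using (_+_; _*_; -_; 0#; 1#; +-identityˡ; +-identityʳ; +-assoc; *-assoc; *-comm;
           *-identityˡ; *-identityʳ; zeroˡ; zeroʳ; distribˡ; distribʳ; -‿inverseʳ;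
           +-commutativeSemigroup; *-commutativeSemigroup; +-abelianGroup)
  open FiniteField F using (inverse)
  open RingProperties (CommutativeRing.ring commutativeRing) using (-1*x≈-x)
  open AbelianGroupProperties +-abelianGroup using (x∙y⁻¹≈ε⇒x≈y)
  open CommutativeSemigroupProperties +-commutativeSemigroup using (interchange)
  open CommutativeSemigroupProperties *-commutativeSemigroup using (x∙yz≈y∙xz)
  open ≡-Reasoning

  private
    ∑ : ∀ {m} → (Fin m → Fin q) → Fin q
    ∑ = sumF F

  sumF-cong : ∀ {m} {f g : Fin m → Fin q} → f ≗ g → ∑ f ≡ ∑ g
  sumF-cong {zero} _ = refl
  sumF-cong {suc m} f≗g = cong₂ _+_ (f≗g Fin.zero) (sumF-cong (λ i → f≗g (Fin.suc i)))

  sumF-0 : ∀ {m} {f : Fin m → Fin q} → f ≗ const 0# → ∑ f ≡ 0#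
  sumF-0 {zero} _ = refl
  sumF-0 {suc m} f≗0 =
    trans (cong₂ _+_ (f≗0 Fin.zero) (sumF-0 (λ i → f≗0 (Fin.suc i)))) (+-identityˡ 0#)

  sumF-+ : ∀ {m} (f g : Fin m → Fin q) → ∑ (λ i → f i + g i) ≡ ∑ f + ∑ g
  sumF-+ {zero} _ _ = sym (+-identityˡ 0#)
  sumF-+ {suc m} f g = begin
    (f Fin.zero + g Fin.zero) + ∑ (λ i → f (Fin.suc i) + g (Fin.suc i))
      ≡⟨ cong (f Fin.zero + g Fin.zero +_) (sumF-+ (λ i → f (Fin.suc i)) (λ i → g (Fin.suc i))) ⟩
    (f Fin.zero + g Fin.zero) + (∑ (λ i → f (Fin.suc i)) + ∑ (λ i → g (Fin.suc i)))
      ≡⟨ interchange _ _ _ _ ⟩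
    ∑ f + ∑ g ∎

  sumF-*ˡ : ∀ {m} x (f : Fin m → Fin q) → ∑ (λ i → x * f i) ≡ x * ∑ f
  sumF-*ˡ {zero} x _ = sym (zeroʳ x)
  sumF-*ˡ {suc m} x f =
    trans (cong (x * f Fin.zero +_) (sumF-*ˡ x (λ i → f (Fin.suc i)))) (sym (distribˡ x _ _))

  sumF-comm : ∀ {m p} (f : Fin m → Fin p → Fin q) → ∑ (λ j → ∑ (λ i → f i j)) ≡ ∑ (λ i → ∑ (f i))
  sumF-comm {zero} {p} _ = sumF-0 {p} (λ _ → refl)
  sumF-comm {suc m} {p} f =
    trans (sumF-+ {p} _ _) (cong (∑ (f Fin.zero) +_) (sumF-comm (λ i → f (Fin.suc i))))

  sumF-init-last : ∀ {m} (f : Fin (suc m) → Fin q) → ∑ f ≡ ∑ (init f) + last f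
  sumF-init-last {zero} f = trans (+-identityʳ (f Fin.zero)) (sym (+-identityˡ (f Fin.zero)))
  sumF-init-last {suc m} f =
    trans (cong (f Fin.zero +_) (sumF-init-last (λ i → f (Fin.suc i)))) (sym (+-assoc _ _ _))

  δ : ∀ {m} → Fin m → Fin m → Fin q
  δ Fin.zero    Fin.zero    = 1#
  δ Fin.zero    (Fin.suc _) = 0#
  δ (Fin.suc _) Fin.zero    = 0#
  δ (Fin.suc k) (Fin.suc j) = δ k j

  sumF-δ : ∀ {m} (d : Fin m → Fin q) k → ∑ (λ j → d j * δ k j) ≡ d k
  sumF-δ {suc m} d Fin.zero =
    trans (cong₂ _+_ (*-identityʳ _) (sumF-0 {m} (λ j → zeroʳ (d (Fin.suc j))))) (+-identityʳ _)
  sumF-δ {suc m} d (Fin.suc k) =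
    trans (cong₂ _+_ (zeroʳ _) (sumF-δ (λ j → d (Fin.suc j)) k)) (+-identityˡ _)

  dot : ∀ {t} → Vect F t → Vect F t → Fin q
  dot u v = ∑ (λ j → u j * v j)

  dot-init-last : ∀ {s} (u v : Vect F (suc s)) → dot u v ≡ dot (init u) (init v) + last u * last v
  dot-init-last u v = sumF-init-last (λ j → u j * v j)

  dot-zeroˡ : ∀ {t} {u : Vect F t} (v : Vect F t) → u ≗ const 0# → dot u v ≡ 0#
  dot-zeroˡ v u≗0 = sumF-0 (λ j → trans (cong (_* v j) (u≗0 j)) (zeroˡ (v j)))

  dot-cong : ∀ {t} {u u′ : Vect F t} (v : Vect F t) → u ≗ u′ → dot u v ≡ dot u′ v
  dot-cong v u≗u′ = sumF-cong (λ j → cong (_* v j) (u≗u′ j))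

  linComb : ∀ {m t} → (Fin m → Vect F t) → Vect F m → Vect F t
  linComb v c j = ∑ (λ i → c i * v i j)

  transpose : ∀ {m t} → (Fin m → Vect F t) → Fin t → Vect F m
  transpose v j i = v i j

  linComb-cong : ∀ {m t} (v : Fin m → Vect F t) {c d : Vect F m} → c ≗ d → linComb v c ≗ linComb v d
  linComb-cong v c≗d j = sumF-cong (λ i → cong (_* v i j) (c≗d i))

  linComb-+ : ∀ {m t} (v : Fin m → Vect F t) (c d : Vect F m) →
    linComb v (λ i → c i + d i) ≗ λ j → linComb v c j + linComb v d j
  linComb-+ {m} v c d j = trans (sumF-cong (λ i → distribʳ (v i j) (c i) (d i))) (sumF-+ {m} _ _)

  linComb-*ˡ : ∀ {m t} (v : Fin m → Vect F t) x (c : Vect F m) →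
    linComb v (λ i → x * c i) ≗ λ j → x * linComb v c j
  linComb-*ˡ {m} v x c j = trans (sumF-cong (λ i → *-assoc x (c i) (v i j))) (sumF-*ˡ {m} x _)

  LinIndep⇒linComb-injective : ∀ {m t} (v : Fin m → Vect F t) → LinIndep F v →
    ∀ {c d} → linComb v c ≗ linComb v d → c ≗ d
  LinIndep⇒linComb-injective v independent {c} {d} same i =
    x∙y⁻¹≈ε⇒x≈y (c i) (d i)
      (trans (cong (c i +_) (sym (-1*x≈-x (d i)))) (independent c-d c-d↦0 i))
    where
    c-d = λ i → c i + - 1# * d i
    c-d↦0 : ∀ j → linComb v c-d j ≡ 0#
    c-d↦0 j = begin
      linComb v c-d j                                   ≡⟨ linComb-+ v c _ j ⟩
      linComb v c j + linComb v (λ i → - 1# * d i) j    ≡⟨ cong₂ _+_ (same j) (linComb-*ˡ v (- 1#) d j) ⟩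
      linComb v d j + - 1# * linComb v d j              ≡⟨ cong (linComb v d j +_) (-1*x≈-x _) ⟩
      linComb v d j + - linComb v d j                   ≡⟨ -‿inverseʳ _ ⟩
      0#                                                ∎

  LinIndep⇒spanning : ∀ {t} (v : Fin t → Vect F t) → LinIndep F v →
    ∀ w → ∃ λ c → linComb v c ≗ w
  LinIndep⇒spanning v independent =
    ≗-injective⇒surjective (linComb v) (linComb-cong v) (LinIndep⇒linComb-injective v independent)

  -- d_k = d · e_k, and e_k = ∑ c_i v_i by spanning, so d_k = ∑ c_i (d · v_i) = 0.
  LinIndep-transpose : ∀ {t} (v : Fin t → Vect F t) → LinIndep F v → LinIndep F (transpose v)
  LinIndep-transpose {t} v independent d d↦0 k = begin
    d k                                       ≡⟨ sumF-δ d k ⟨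
    ∑ (λ j → d j * δ k j)                     ≡⟨ sumF-cong (λ j → cong (d j *_) (c↦δ j)) ⟨
    ∑ (λ j → d j * ∑ (λ i → c i * v i j))     ≡⟨ sumF-cong (λ j → sumF-*ˡ {t} (d j) _) ⟨
    ∑ (λ j → ∑ (λ i → d j * (c i * v i j)))   ≡⟨ sumF-comm {t} {t} _ ⟩
    ∑ (λ i → ∑ (λ j → d j * (c i * v i j)))   ≡⟨ sumF-cong (λ i → sumF-cong (λ j → x∙yz≈y∙xz (d j) (c i) (v i j))) ⟩
    ∑ (λ i → ∑ (λ j → c i * (d j * v i j)))   ≡⟨ sumF-cong (λ i → sumF-*ˡ {t} (c i) _) ⟩
    ∑ (λ i → c i * dot d (v i))               ≡⟨ sumF-0 (λ i → trans (cong (c i *_) (d↦0 i)) (zeroʳ _)) ⟩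
    0#                                        ∎
    where
    c = proj₁ (LinIndep⇒spanning v independent (δ k))
    c↦δ = proj₂ (LinIndep⇒spanning v independent (δ k))

  LinIndep⇒solvable : ∀ {t} (v : Fin t → Vect F t) → LinIndep F v →
    ∀ w → ∃ λ u → ∀ i → dot u (v i) ≡ w i
  LinIndep⇒solvable v independent =
    LinIndep⇒spanning (transpose v) (LinIndep-transpose v independent)

  inverse-cancelˡ : ∀ {x y} z → x * y ≡ 1# → y * (x * z) ≡ z
  inverse-cancelˡ {x} {y} z xy≡1 = begin
    y * (x * z)   ≡⟨ sym (*-assoc y x z) ⟩
    (y * x) * z   ≡⟨ cong (_* z) (trans (*-comm y x) xy≡1) ⟩
    1# * z        ≡⟨ *-identityˡ z ⟩
    z             ∎

  *-cancelˡ-invertible : ∀ {x y} z z′ → x * y ≡ 1# → x * z ≡ x * z′ → z ≡ z′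
  *-cancelˡ-invertible z z′ xy≡1 xz≡xz′ =
    trans (sym (inverse-cancelˡ z xy≡1)) (trans (cong (_ *_) xz≡xz′) (inverse-cancelˡ z′ xy≡1))

  -- Fin (q ^ t) codes Vect F t; removing the code of the zero vector enumerates the rest.
  module _ {t : ℕ} where
    private
      code-size : q ℕ.^ t ≡ suc (q ℕ.^ t ℕ.∸ 1)
      code-size = m^n≡1+[m^n∸1] q {{nonZeroIndex 0#}} t
      encode : Vect F t → Fin (suc (q ℕ.^ t ℕ.∸ 1))
      encode u = cast code-size (funToFin u)
      decode : Fin (suc (q ℕ.^ t ℕ.∸ 1)) → Vect F t
      decode x = finToFun (cast (sym code-size) x)
      decode-encode : ∀ u → decode (encode u) ≗ u
      decode-encode u j =
        trans (cong (λ x → finToFun x j) (cast-involutive (sym code-size) code-size _)) (finToFun-funToFin u j)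

    nonzeroVect : Fin (q ℕ.^ t ℕ.∸ 1) → Vect F t
    nonzeroVect = decode ∘′ punchIn (encode (const 0#))

    nonzeroVect-surjective : ∀ u → NonZeroVec F u → ∃ λ i → nonzeroVect i ≗ u
    nonzeroVect-surjective u u≢0 =
      punchOut 0≢u , λ j → trans (cong (λ x → decode x j) (punchIn-punchOut 0≢u)) (decode-encode u j)
      where
      0≢u : encode (const 0#) ≢ encode u
      0≢u same = u≢0 λ j →
        trans (sym (decode-encode u j)) (trans (cong (λ x → decode x j) (sym same)) (decode-encode (const 0#) j))

  weakenCPHF : ∀ {lam lam′ n t k} → lam′ ℕ.≤ lam → CPHF F lam n t k → CPHF F lam′ n t k
  weakenCPHF lam′≤lam C = record
    { entry   = entry
    ; nonzero = nonzero
    ; covers  = λ cols cols-injective →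
        let rows , rows-injective , independent = covers cols cols-injective in
        (λ j → rows (inject≤ j lam′≤lam)) ,
        (λ eq → inject≤-injective lam′≤lam lam′≤lam _ _ (rows-injective eq)) ,
        (λ j → independent (inject≤ j lam′≤lam))
    }
    where open CPHF C

  CPHF⇒CA : ∀ {lam n t k} → CPHF F lam n t k → CA lam (n ℕ.* (q ℕ.^ t ℕ.∸ 1) ℕ.+ lam) t k q
  CPHF⇒CA {lam} {n} {t} {k} C = Covers⇒CA (↔-trans +↔⊎ (*↔× ⊎-↔ ↔-refl)) row row-covers
    where
    open CPHF C
    row : (Fin n × Fin (q ℕ.^ t ℕ.∸ 1)) ⊎ Fin lam → Fin k → Fin q
    row (inj₁ (r , i)) c = dot (nonzeroVect i) (entry r c)
    row (inj₂ _)       _ = 0#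

    row-covers : Covers lam t row
    row-covers cols cols-injective w with all? (λ i → w i ≟ 0#)
    ... | yes w≗0 = inj₂ , inj₂-injective , λ _ i → sym (w≗0 i)
    ... | no w≢0 = (λ j → inj₁ (rows j , index j)) , inj₁-pair-injective index rows-injective , hit
      where
      rows = proj₁ (covers cols cols-injective)
      rows-injective = proj₁ (proj₂ (covers cols cols-injective))
      solution : ∀ j → ∃ λ u → ∀ i → dot u (entry (rows j) (cols i)) ≡ w i
      solution j = LinIndep⇒solvable (λ i → entry (rows j) (cols i)) (proj₂ (proj₂ (covers cols cols-injective)) j) w
      solution≢0 : ∀ j → NonZeroVec F (proj₁ (solution j))
      solution≢0 j u≗0 = w≢0 λ i →
        trans (sym (proj₂ (solution j) i)) (dot-zeroˡ _ u≗0)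
      index : ∀ j → Fin (q ℕ.^ t ℕ.∸ 1)
      index j = proj₁ (nonzeroVect-surjective _ (solution≢0 j))
      hit : ∀ j i → row (inj₁ (rows j , index j)) (cols i) ≡ w i
      hit j i = trans (dot-cong _ (proj₂ (nonzeroVect-surjective _ (solution≢0 j)))) (proj₂ (solution j) i)

  SherwoodCPHF⇒CA : ∀ {lam n s k} (C : CPHF F lam n (suc s) k) → IsSherwood F C →
    CA lam (n ℕ.* (q ℕ.^ suc s ℕ.∸ q) ℕ.+ lam ℕ.* q) (suc s) k q
  SherwoodCPHF⇒CA {lam} {n} {s} {k} C sherwood =
    subst (λ N → CA lam (n ℕ.* N ℕ.+ lam ℕ.* q) (suc s) k q) ([m^n∸1]*m≡m^[1+n]∸m q s)
      (Covers⇒CA (↔-trans +↔⊎ (↔-trans *↔× (↔-refl ×-↔ *↔×) ⊎-↔ *↔×)) row row-covers)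
    where
    open CPHF C
    b : Fin n → Fin k → Fin q
    b r c = last (entry r c)
    b≢0 : ∀ r c → b r c ≢ 0#
    b≢0 r c = sherwood r c (fromℕ s) (toℕ-fromℕ s)
    b⁻¹ : Fin n → Fin k → Fin q
    b⁻¹ r c = proj₁ (inverse (b r c) (b≢0 r c))
    bb⁻¹≡1 : ∀ r c → b r c * b⁻¹ r c ≡ 1#
    bb⁻¹≡1 r c = proj₂ (inverse (b r c) (b≢0 r c))

    -- An index (r , i , a) stands for u = (nonzeroVect i , a), since u · C(r,c) = init u · init C(r,c) + a b.
    row : (Fin n × Fin (q ℕ.^ s ℕ.∸ 1) × Fin q) ⊎ (Fin lam × Fin q) → Fin k → Fin q
    row (inj₁ (r , i , a)) c = b⁻¹ r c * (dot (nonzeroVect i) (init (entry r c)) + a * b r c)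
    row (inj₂ (_ , a))     _ = a

    row-covers : Covers lam (suc s) row
    row-covers cols cols-injective w with all? (λ i → w i ≟ w Fin.zero)
    ... | yes constant = (λ j → inj₂ (j , w Fin.zero)) ,
                         (λ eq → cong proj₁ (inj₂-injective eq)) ,
                         λ _ i → sym (constant i)
    ... | no nonconstant = (λ j → inj₁ (rows j , index j , last (u j))) ,
                           inj₁-pair-injective (λ j → index j , last (u j)) rows-injective ,
                           hit
      where
      rows = proj₁ (covers cols cols-injective)
      rows-injective = proj₁ (proj₂ (covers cols cols-injective))
      A : Fin lam → Fin (suc s) → Vect F (suc s)
      A j i = entry (rows j) (cols i)
      bA : Fin lam → Fin (suc s) → Fin q
      bA j i = b (rows j) (cols i)
      solution : ∀ j → ∃ λ u → ∀ i → dot u (A j i) ≡ bA j i * w i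
      solution j = LinIndep⇒solvable (A j) (proj₂ (proj₂ (covers cols cols-injective)) j) (λ i → bA j i * w i)
      u = λ j → proj₁ (solution j)
      init-u≢0 : ∀ j → NonZeroVec F (init (u j))
      init-u≢0 j init≗0 = nonconstant λ i → trans (w≡last i) (sym (w≡last Fin.zero))
        where
        w≡last : ∀ i → w i ≡ last (u j)
        w≡last i = *-cancelˡ-invertible (w i) (last (u j)) (bb⁻¹≡1 (rows j) (cols i)) (begin
          bA j i * w i                                        ≡⟨ proj₂ (solution j) i ⟨
          dot (u j) (A j i)                                   ≡⟨ dot-init-last (u j) (A j i) ⟩
          dot (init (u j)) (init (A j i)) + last (u j) * bA j i
            ≡⟨ cong (_+ last (u j) * bA j i) (dot-zeroˡ (init (A j i)) init≗0) ⟩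
          0# + last (u j) * bA j i                            ≡⟨ +-identityˡ _ ⟩
          last (u j) * bA j i                                 ≡⟨ *-comm _ _ ⟩
          bA j i * last (u j)                                 ∎)
      index : ∀ j → Fin (q ℕ.^ s ℕ.∸ 1)
      index j = proj₁ (nonzeroVect-surjective _ (init-u≢0 j))
      hit : ∀ j i → row (inj₁ (rows j , index j , last (u j))) (cols i) ≡ w i
      hit j i = begin
        b⁻¹ (rows j) (cols i) * (dot (nonzeroVect (index j)) (init (A j i)) + last (u j) * bA j i)
          ≡⟨ cong (λ x → b⁻¹ (rows j) (cols i) * (x + last (u j) * bA j i))
                  (dot-cong _ (proj₂ (nonzeroVect-surjective _ (init-u≢0 j)))) ⟩
        b⁻¹ (rows j) (cols i) * (dot (init (u j)) (init (A j i)) + last (u j) * bA j i)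
          ≡⟨ cong (b⁻¹ (rows j) (cols i) *_) (trans (sym (dot-init-last (u j) (A j i))) (proj₂ (solution j) i)) ⟩
        b⁻¹ (rows j) (cols i) * (bA j i * w i)
          ≡⟨ inverse-cancelˡ (w i) (bb⁻¹≡1 (rows j) (cols i)) ⟩
        w i ∎

open import Data.Nat using (_+_; _*_; _∸_; _^_; _≤_)

theorem4p3 : (q t n k lam lam' : ℕ) → IsPrimePower q → (F : FiniteField q) →
    1 ≤ t → 1 ≤ n → 1 ≤ k → 1 ≤ lam' → lam' ≤ lam →
    (C : CPHF F lam n t k) →
    CA lam' (n * (q ^ t ∸ 1) + lam') t k q ×
    (IsSherwood F C → CA lam' (n * (q ^ t ∸ q) + lam' * q) t k q)
theorem4p3 q (suc s) n k lam lam' _ F (s≤s z≤n) _ _ _ lam'≤lam C =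
  CPHF⇒CA F C′ , SherwoodCPHF⇒CA F C′
  where
  C′ = weakenCPHF F lam'≤lam C
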